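{- Let $G$ be a totally ordered graph and let $k,r$ be integers with $1\le k<r$. Then every monotone path $x_0x_1\ldots x_k$ in $G$ of length $k$ and height $r$ extends to a monotone path $x_0x_1\ldots x_kx_{k+1}$ of length $k+1$ and height at least $r-k$.
   Context: A totally ordered graph is a (finite) graph $G$ together with a total ordering $T(G)$ of $V(G)$ and a total ordering $T'(G)$ of $E(G)$. A monotone path is a path $x_0x_1\ldots x_k$ whose edges $x_0x_1,\ldots,x_{k-1}x_k$ are increasing in $T'(G)$; its length is $k$. The height table of $G$ is an array $A$ with columns indexed by $V(G)$ and rows indexed by the positive integers; cell $A(i,u)$ precedes $A(i',u')$ iff $i<i'$, or $i=i'$ and $u$ precedes $u'$ in $T(G)$. The cells are filled in this order: $A(i,u)$ is the largest edge (in $T'(G)$) incident to $u$ that does not appear in a preceding cell, and is empty if no such edge exists. Each edge appears in exactly one cell; the height $h_G(e)$ of an edge $e$ is the index of the row of $A$ containing $e$. The height of a monotone path $x_0\ldots x_k$ with $k\ge1$ is the height of its last edge $x_{k-1}x_k$. -}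

module Defs where

open import Data.Nat using (ℕ; zero; suc; _≤_)
open import Data.Fin using (Fin; zero; suc; inject₁; fromℕ; _<_; _≟_)
open import Data.Product using (_×_; _,_; proj₁; proj₂)
open import Data.Sum using (_⊎_; inj₁; inj₂)
open import Relation.Nullary.Decidable using (_⊎-dec_; _×-dec_)
open import Data.Nat using () renaming (_≟_ to _≟ℕ_)
open import Data.Empty using (⊥)
open import Data.Maybe using (Maybe; just; nothing)
open import Data.List using (List; head; filter; reverse; foldl; allFin)
open import Data.Bool using (if_then_else_)
open import Function using (_∘_; const)
open import Relation.Nullary using (¬_; Dec; does)
open import Relation.Binary.PropositionalEquality using (_≡_; _≢_)

SameEnds : ∀ {n} → Fin n × Fin n → Fin n × Fin n → Set
SameEnds (a , b) (c , d) = (a ≡ c × b ≡ d) ⊎ (a ≡ d × b ≡ c)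

-- Vertices are Fin n; the vertex order T(G) is the natural order on Fin n.
-- Edges are Fin m; the edge order T'(G) is the natural order on Fin m.
-- ends e gives the two endpoints of edge e.
record TOGraph : Set where
  field
    n : ℕ
    m : ℕ
    ends     : Fin m → Fin n × Fin n
    loopless : ∀ e → proj₁ (ends e) ≢ proj₂ (ends e)
    simple   : ∀ e f → SameEnds (ends e) (ends f) → e ≡ f

module _ (G : TOGraph) where
  open TOGraph G

  Incident : Fin m → Fin n → Set
  Incident e u = (proj₁ (ends e) ≡ u) ⊎ (proj₂ (ends e) ≡ u)

  incident? : ∀ e u → Dec (Incident e u)
  incident? e u = (proj₁ (ends e) ≟ u) ⊎-dec (proj₂ (ends e) ≟ u)

  Joins : Fin m → Fin n → Fin n → Set
  Joins e a b = SameEnds (ends e) (a , b)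

  -- Partial height table: a function Fin m → ℕ where 0 means
  -- "not yet placed" and i ≥ 1 means "placed in row i".
  Table : Set
  Table = Fin m → ℕ

  largestFree : Table → Fin n → Maybe (Fin m)
  largestFree h u =
    head (filter (λ e → (h e ≟ℕ 0) ×-dec incident? e u) (reverse (allFin m)))

  fillCell : ℕ → Table → Fin n → Table
  fillCell i h u with largestFree h u
  ... | nothing = h
  ... | just e  = λ f → if does (f ≟ e) then i else h f

  fillRow : ℕ → Table → Table
  fillRow i h = foldl (fillCell i) h (allFin n)

  rowsUpTo : ℕ → Table
  rowsUpTo zero    = const 0
  rowsUpTo (suc i) = fillRow (suc i) (rowsUpTo i)

  -- Height of an edge: m rows always suffice to place all m edges.
  height : Fin m → ℕ
  height = rowsUpTo m

  record MonotonePath (k : ℕ) (x : Fin (suc k) → Fin n) (e : Fin k → Fin m) : Set where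
    field
      distinct   : ∀ i j → x i ≡ x j → i ≡ j
      joins      : ∀ i → Joins (e i) (x (inject₁ i)) (x (suc i))
      increasing : ∀ i j → i Data.Fin.< j → e i Data.Fin.< e j

  PathHeight : (k : ℕ) → (Fin k → Fin m) → ℕ → Set
  PathHeight zero    e r = ⊥
  PathHeight (suc j) e r = height (e (fromℕ j)) ≡ r

snoc : ∀ {A : Set} {k} → (Fin k → A) → A → Fin (suc k) → A
snoc {k = zero}  f a zero    = a
snoc {k = suc k} f a zero    = f zero
snoc {k = suc k} f a (suc i) = snoc (f ∘ suc) a i

module Submission where

-- Let x₀ … x_k be a monotone path of height r > k, with last edge
-- e = x_{k-1}x_k.  For every row c with r - k ≤ c < r the edge e was still
-- unplaced when the cell A(c, x_k) was filled, so that cell holds an edge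
-- f_c ≥ e at x_k (the largest unplaced one); as f_c has height c ≠ r, in
-- fact f_c > e.  The k edges f_c are distinct, hence so are their far ends
-- y_c, and none of them is x_k (no loops) or x_{k-1} (the only edge
-- x_k x_{k-1} is e).  Together with x_k and x_{k-1} these are k + 2
-- distinct vertices, while the path has only k + 1, so some y_c lies off
-- the path, and x₀ … x_k y_c is the required extension, of height c ≥ r-k.

open import Defs
open import Data.Nat using (ℕ; zero; suc; _≤_; _<_; _∸_; z≤n; s≤s; _≤′_; ≤′-refl; ≤′-step)
import Data.Nat.Properties as ℕP
open import Data.Fin as F using (Fin; zero; suc; toℕ; inject₁; fromℕ; _≟_)
import Data.Fin.Properties as FP
open import Data.Fin.Relation.Unary.Top using (view; ‵fromℕ; ‵inject₁)
import Data.Vec.Functional as Vector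
open import Data.List using (List; []; _∷_; [_]; _++_; head; filter; reverse; foldl; allFin)
import Data.List.Properties as LP
import Data.List.Relation.Unary.All as All
open import Data.List.Relation.Unary.Any using (here; there)
import Data.List.Relation.Unary.Any.Properties as AnyP
open import Data.List.Relation.Unary.AllPairs using (AllPairs; []; _∷_)
import Data.List.Relation.Unary.AllPairs.Properties as AllPairsP
open import Data.List.Membership.Propositional using (_∈_)
import Data.List.Membership.Propositional.Properties as MembershipP
open import Data.Maybe using (just; nothing)
open import Data.Bool using (if_then_else_)
open import Data.Product using (Σ; ∃; _×_; _,_; proj₁; proj₂)
open import Data.Sum using (inj₁; inj₂)
open import Function using (_∘_)
open import Function.Definitions using (Injective)
open import Relation.Nullary using (yes; no; does; ¬?; contradiction)
open import Relation.Nullary.Decidable using (_×-dec_; decidable-stable)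
open import Relation.Unary using (Pred; Decidable)
open import Level using (0ℓ)
open import Relation.Binary.PropositionalEquality
  using (_≡_; _≢_; refl; sym; trans; cong; subst; subst₂)
open import Data.Nat using () renaming (_≟_ to _≟ℕ_)

head-∈ : ∀ {A : Set} (xs : List A) {a} → head xs ≡ just a → a ∈ xs
head-∈ (x ∷ xs) refl = here refl

module LargestSatisfying {m : ℕ} {P : Pred (Fin m) 0ℓ} (P? : Decidable P) where

  private
    head-++ : ∀ (xs ys : List (Fin m)) {a} → head xs ≡ just a → head (xs ++ ys) ≡ just a
    head-++ (x ∷ xs) ys eq = eq

  backward-search-max : ∀ xs → AllPairs F._<_ xs → ∀ {e} → e ∈ xs → P e →
    ∃ λ e′ → head (filter P? (reverse xs)) ≡ just e′ × P e′ × e F.≤ e′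
  backward-search-max (x ∷ xs) (x<xs ∷ ascending) {e} e∈ Pe
    rewrite LP.unfold-reverse x xs | LP.filter-++ P? (reverse xs) [ x ] with e∈
  ... | there e∈xs =
    let (e′ , found , Pe′ , e≤e′) = backward-search-max xs ascending e∈xs Pe
    in e′ , head-++ _ _ found , Pe′ , e≤e′
  ... | here refl with filter P? (reverse xs) in found
  ...   | y ∷ _ = y , refl , proj₂ y∈ , ℕP.<⇒≤ (All.lookup x<xs (AnyP.reverse⁻ (proj₁ y∈)))
    where y∈ = MembershipP.∈-filter⁻ P? (subst (y ∈_) (sym found) (here refl))
  ...   | [] with P? x
  ...     | yes Px = x , refl , Px , ℕP.≤-refl
  ...     | no ¬Px = contradiction Pe ¬Px

  backward-search-sound : ∀ xs {e} → head (filter P? (reverse xs)) ≡ just e → P e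
  backward-search-sound xs found =
    proj₂ (MembershipP.∈-filter⁻ P? {xs = reverse xs} (head-∈ _ found))

module HeightTable (G : TOGraph) where
  open TOGraph G

  _⊑_ : Table G → Table G → Set
  h ⊑ h′ = ∀ f c → h f ≡ suc c → h′ f ≡ suc c

  ⊑-refl : ∀ {h} → h ⊑ h
  ⊑-refl f c placed = placed

  ⊑-trans : ∀ {h₁ h₂ h₃} → h₁ ⊑ h₂ → h₂ ⊑ h₃ → h₁ ⊑ h₃
  ⊑-trans p q f c = q f c ∘ p f c

  unplaced-before : ∀ {h h′} → h ⊑ h′ → ∀ f → h′ f ≡ 0 → h f ≡ 0
  unplaced-before {h} p f unplaced with h f in placed
  ... | zero  = refl
  ... | suc c = contradiction (trans (sym unplaced) (p f c placed)) (λ ())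

  Bounded : ℕ → Table G → Set
  Bounded i h = ∀ f → h f ≤ i

  free? : (h : Table G) (u : Fin n) → Decidable (λ f → h f ≡ 0 × Incident G f u)
  free? h u f = (h f ≟ℕ 0) ×-dec incident? G f u

  largestFree-max : ∀ h u e → h e ≡ 0 → Incident G e u →
    ∃ λ e′ → largestFree G h u ≡ just e′ × (h e′ ≡ 0 × Incident G e′ u) × e F.≤ e′
  largestFree-max h u e free incident =
    backward-search-max (allFin m) (AllPairsP.tabulate⁺-< (λ i<j → i<j))
      (MembershipP.∈-allFin e) (free , incident)
    where open LargestSatisfying (free? h u)

  largestFree-unplaced : ∀ h u e → largestFree G h u ≡ just e → h e ≡ 0
  largestFree-unplaced h u e found =
    proj₁ (LargestSatisfying.backward-search-sound (free? h u) (allFin m) found)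

  fillCell-⊑ : ∀ i h u → h ⊑ fillCell G i h u
  fillCell-⊑ i h u with largestFree G h u in found
  ... | nothing = ⊑-refl
  ... | just e  = keep
    where
    keep : ∀ f c → h f ≡ suc c → (if does (f ≟ e) then i else h f) ≡ suc c
    keep f c placed with f ≟ e
    ... | yes refl = contradiction (trans (sym placed) (largestFree-unplaced h u f found)) (λ ())
    ... | no _     = placed

  fillCell-bounded : ∀ i h u → Bounded i h → Bounded i (fillCell G i h u)
  fillCell-bounded i h u bounded with largestFree G h u
  ... | nothing = bounded
  ... | just e  = bound
    where
    bound : ∀ f → (if does (f ≟ e) then i else h f) ≤ i
    bound f with f ≟ e
    ... | yes _ = ℕP.≤-refl
    ... | no _  = bounded f

  fillCell-places : ∀ i h u e → largestFree G h u ≡ just e → fillCell G i h u e ≡ i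
  fillCell-places i h u e found rewrite found with e ≟ e
  ... | yes _  = refl
  ... | no e≢e = contradiction refl e≢e

  fillCells-⊑ : ∀ i us h → h ⊑ foldl (fillCell G i) h us
  fillCells-⊑ i []       h = ⊑-refl
  fillCells-⊑ i (u ∷ us) h = ⊑-trans (fillCell-⊑ i h u) (fillCells-⊑ i us (fillCell G i h u))

  fillCells-bounded : ∀ i us h → Bounded i h → Bounded i (foldl (fillCell G i) h us)
  fillCells-bounded i []       h bounded = bounded
  fillCells-bounded i (u ∷ us) h bounded =
    fillCells-bounded i us (fillCell G i h u) (fillCell-bounded i h u bounded)

  cell-of : ∀ i us h u → u ∈ us →
    ∃ λ hᵤ → fillCell G i hᵤ u ⊑ foldl (fillCell G i) h us
  cell-of i (v ∷ us) h u (here refl)  = h , fillCells-⊑ i us (fillCell G i h v)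
  cell-of i (v ∷ us) h u (there u∈us) = cell-of i us (fillCell G i h v) u u∈us

  rows-⊑′ : ∀ {i j} → i ≤′ j → rowsUpTo G i ⊑ rowsUpTo G j
  rows-⊑′ ≤′-refl              = ⊑-refl
  rows-⊑′ (≤′-step {n = j} i≤j) =
    ⊑-trans (rows-⊑′ i≤j) (fillCells-⊑ (suc j) (allFin n) (rowsUpTo G j))

  rows-bounded : ∀ i → Bounded i (rowsUpTo G i)
  rows-bounded zero    f = z≤n
  rows-bounded (suc i) =
    fillCells-bounded (suc i) (allFin n) (rowsUpTo G i) (ℕP.m≤n⇒m≤1+n ∘ rows-bounded i)

  height-of-placed : ∀ {i f c} → i ≤ m → rowsUpTo G i f ≡ suc c → height G f ≡ suc c
  height-of-placed {f = f} {c} i≤m = rows-⊑′ (ℕP.≤⇒≤′ i≤m) f c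

  height-bounded : ∀ f → height G f ≤ m
  height-bounded = rows-bounded m

  unplaced-below-height : ∀ i f → i < height G f → rowsUpTo G i f ≡ 0
  unplaced-below-height i f i<h with rowsUpTo G i f in placed
  ... | zero  = refl
  ... | suc d = contradiction (subst (_≤ i) (trans placed (sym final)) (rows-bounded i f)) (ℕP.<⇒≱ i<h)
    where
    final : height G f ≡ suc d
    final = height-of-placed (ℕP.<⇒≤ (ℕP.<-≤-trans i<h (height-bounded f))) placed

  -- The cell lemma: if e is incident to u and lies above row suc c, then
  -- e was unplaced when A(suc c, u) was filled, so that cell holds an edge
  -- e′ ≥ e at u, which therefore has height suc c.
  cell-lemma : ∀ c u e → Incident G e u → suc c < height G e →
    ∃ λ e′ → Incident G e′ u × e F.≤ e′ × height G e′ ≡ suc c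
  cell-lemma c u e incident c<h =
    let (hᵤ , after) = cell-of (suc c) (allFin n) (rowsUpTo G c) u (MembershipP.∈-allFin u)
        e-unplaced   = unplaced-below-height (suc c) e c<h
        (e′ , found , (_ , incident′) , e≤e′) =
          largestFree-max hᵤ u e
            (unplaced-before (⊑-trans (fillCell-⊑ (suc c) hᵤ u) after) e e-unplaced) incident
        row≤m = ℕP.<⇒≤ (ℕP.<-≤-trans c<h (height-bounded e))
    in e′ , incident′ , e≤e′ , height-of-placed row≤m (after e′ c (fillCell-places (suc c) hᵤ u e′ found))

sameEnds-trans : ∀ {N} {p q : Fin N × Fin N} {a b} →
  SameEnds p (a , b) → SameEnds q (a , b) → SameEnds p q
sameEnds-trans {p = _ , _} {_ , _} (inj₁ (refl , refl)) (inj₁ (refl , refl)) = inj₁ (refl , refl)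
sameEnds-trans {p = _ , _} {_ , _} (inj₁ (refl , refl)) (inj₂ (refl , refl)) = inj₂ (refl , refl)
sameEnds-trans {p = _ , _} {_ , _} (inj₂ (refl , refl)) (inj₁ (refl , refl)) = inj₂ (refl , refl)
sameEnds-trans {p = _ , _} {_ , _} (inj₂ (refl , refl)) (inj₂ (refl , refl)) = inj₁ (refl , refl)

module Endpoints (G : TOGraph) where
  open TOGraph G

  joins-sym : ∀ {f a b} → Joins G f a b → Joins G f b a
  joins-sym (inj₁ (p , q)) = inj₂ (p , q)
  joins-sym (inj₂ (p , q)) = inj₁ (p , q)

  joins-incident : ∀ {f a b} → Joins G f a b → Incident G f b
  joins-incident (inj₁ (_ , q)) = inj₂ q
  joins-incident (inj₂ (p , _)) = inj₁ p

  joins-unique : ∀ {f f′ a b} → Joins G f a b → Joins G f′ a b → f ≡ f′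
  joins-unique j j′ = simple _ _ (sameEnds-trans j j′)

  joins-distinct : ∀ {f a b} → Joins G f a b → a ≢ b
  joins-distinct {f} (inj₁ (p , q)) a≡b = loopless f (trans p (trans a≡b (sym q)))
  joins-distinct {f} (inj₂ (p , q)) a≡b = loopless f (trans p (sym (trans q a≡b)))

  other-end : ∀ {f u} → Incident G f u → ∃ λ y → Joins G f u y
  other-end (inj₁ p) = _ , inj₁ (p , refl)
  other-end (inj₂ q) = _ , inj₂ (refl , q)

snoc-inject₁ : ∀ {A : Set} {k} (v : Fin k → A) a (i : Fin k) → snoc v a (inject₁ i) ≡ v i
snoc-inject₁ {k = suc k} v a zero    = refl
snoc-inject₁ {k = suc k} v a (suc i) = snoc-inject₁ (v ∘ suc) a i

snoc-last : ∀ {A : Set} {k} (v : Fin k → A) a → snoc v a (fromℕ k) ≡ a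
snoc-last {k = zero}  v a = refl
snoc-last {k = suc k} v a = snoc-last (v ∘ suc) a

inject₁<fromℕ : ∀ {k} (i : Fin k) → inject₁ i F.< fromℕ k
inject₁<fromℕ zero    = s≤s z≤n
inject₁<fromℕ (suc i) = s≤s (inject₁<fromℕ i)

module Paths (G : TOGraph) where

  edges-below-last : ∀ {k x e} → MonotonePath G (suc k) x e → ∀ i → e i F.≤ e (fromℕ k)
  edges-below-last path i with view i
  ... | ‵fromℕ     = ℕP.≤-refl
  ... | ‵inject₁ j = ℕP.<⇒≤ (MonotonePath.increasing path _ _ (inject₁<fromℕ j))

  extend : ∀ {k x e y f} → MonotonePath G k x e → (∀ j → x j ≢ y) →
    Joins G f (x (fromℕ k)) y → (∀ i → e i F.< f) →
    MonotonePath G (suc k) (snoc x y) (snoc e f)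
  extend {k} {x} {e} {y} {f} path y-fresh f-joins e<f =
    record { distinct = distinct′ ; joins = joins′ ; increasing = increasing′ }
    where
    open MonotonePath path

    old : ∀ a → snoc x y (inject₁ a) ≡ x a
    old = snoc-inject₁ x y

    new : snoc x y (fromℕ (suc k)) ≡ y
    new = snoc-last x y

    distinct′ : ∀ i j → snoc x y i ≡ snoc x y j → i ≡ j
    distinct′ i j eq with view i | view j
    ... | ‵inject₁ a | ‵inject₁ b = cong inject₁ (distinct a b (trans (sym (old a)) (trans eq (old b))))
    ... | ‵inject₁ a | ‵fromℕ     = contradiction (trans (sym (old a)) (trans eq new)) (y-fresh a)
    ... | ‵fromℕ     | ‵inject₁ b = contradiction (trans (sym (old b)) (trans (sym eq) new)) (y-fresh b)
    ... | ‵fromℕ     | ‵fromℕ     = refl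

    joins′ : ∀ i → Joins G (snoc e f i) (snoc x y (inject₁ i)) (snoc x y (suc i))
    joins′ i with view i
    ... | ‵inject₁ a
      rewrite snoc-inject₁ e f a | old (inject₁ a) | old (suc a) = joins a
    ... | ‵fromℕ
      rewrite snoc-last e f | old (fromℕ k) | new = f-joins

    increasing′ : ∀ i j → i F.< j → snoc e f i F.< snoc e f j
    increasing′ i j i<j with view i | view j
    ... | ‵inject₁ a | ‵inject₁ b rewrite snoc-inject₁ e f a | snoc-inject₁ e f b =
      increasing a b (subst₂ _<_ (FP.toℕ-inject₁ a) (FP.toℕ-inject₁ b) i<j)
    ... | ‵inject₁ a | ‵fromℕ rewrite snoc-inject₁ e f a | snoc-last e f = e<f a
    ... | ‵fromℕ     | ‵inject₁ b = contradiction i<j (ℕP.<-asym (inject₁<fromℕ b))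
    ... | ‵fromℕ     | ‵fromℕ     = contradiction i<j (ℕP.<-irrefl refl)

cons-injective : ∀ {A : Set} {n a} {w : Fin n → A} →
  (∀ i → a ≢ w i) → Injective _≡_ _≡_ w → Injective _≡_ _≡_ (a Vector.∷ w)
cons-injective a-fresh w-injective {zero}  {zero}  _  = refl
cons-injective a-fresh w-injective {zero}  {suc j} eq = contradiction eq (a-fresh j)
cons-injective a-fresh w-injective {suc i} {zero}  eq = contradiction (sym eq) (a-fresh i)
cons-injective a-fresh w-injective {suc i} {suc j} eq = cong suc (w-injective eq)

fresh-among : ∀ {a N} (x : Fin a → Fin N) (w : Fin (suc a) → Fin N) →
  Injective _≡_ _≡_ w → ∃ λ i → ∀ j → x j ≢ w i
fresh-among {a} x w w-injective with FP.any? (λ i → FP.all? (λ j → ¬? (x j ≟ w i)))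
... | yes found = found
... | no none   = contradiction (FP.injective⇒≤ index-injective) ℕP.1+n≰n
  where
  in-image : ∀ i → ∃ λ j → x j ≡ w i
  in-image i = decidable-stable (FP.any? (λ j → x j ≟ w i))
                                (λ missing → none (i , λ j eq → missing (j , eq)))

  index : Fin (suc a) → Fin a
  index = proj₁ ∘ in-image

  index-injective : Injective _≡_ _≡_ index
  index-injective {i} {i′} eq =
    w-injective (trans (sym (proj₂ (in-image i))) (trans (cong x eq) (proj₂ (in-image i′))))

-- The situation of the theorem: a monotone path x₀ … x_{k+1} whose last edge
-- x_k x_{k+1} has height r + 2, where k ≤ r.
module LastVertex (G : TOGraph) {k r : ℕ} (k≤r : k ≤ r)
  (x : Fin (suc (suc k)) → Fin (TOGraph.n G)) (e : Fin (suc k) → Fin (TOGraph.m G))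
  (path : MonotonePath G (suc k) x e) (last-height : height G (e (fromℕ k)) ≡ suc (suc r))
  where
  open TOGraph G
  open HeightTable G
  open Endpoints G
  open Paths G

  u v : Fin n
  u = x (fromℕ (suc k))
  v = x (inject₁ (fromℕ k))

  last : Fin m
  last = e (fromℕ k)

  last-joins : Joins G last v u
  last-joins = MonotonePath.joins path (fromℕ k)

  -- The t-th fan edge lies in row suc (row t); these are the k + 1 rows
  -- just below the height of the last edge.
  row : Fin (suc k) → ℕ
  row t = r ∸ toℕ t

  t≤r : (t : Fin (suc k)) → toℕ t ≤ r
  t≤r t = ℕP.≤-trans (FP.toℕ≤pred[n] t) k≤r

  row-injective : ∀ {t t′} → row t ≡ row t′ → t ≡ t′
  row-injective {t} {t′} = FP.toℕ-injective ∘ ℕP.∸-cancelˡ-≡ (t≤r t) (t≤r t′)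

  row<r : (t : Fin (suc k)) → suc (row t) < suc (suc r)
  row<r t = s≤s (s≤s (ℕP.m∸n≤m r (toℕ t)))

  fan : ∀ t → ∃ λ f → Incident G f u × last F.≤ f × height G f ≡ suc (row t)
  fan t = cell-lemma (row t) u last (joins-incident last-joins)
                     (subst (suc (row t) <_) (sym last-height) (row<r t))

  f : Fin (suc k) → Fin m
  f = proj₁ ∘ fan

  f-height : ∀ t → height G (f t) ≡ suc (row t)
  f-height t = proj₂ (proj₂ (proj₂ (fan t)))

  y : Fin (suc k) → Fin n
  y t = proj₁ (other-end (proj₁ (proj₂ (fan t))))

  y-joins : ∀ t → Joins G (f t) u (y t)
  y-joins t = proj₂ (other-end (proj₁ (proj₂ (fan t))))

  f-injective : ∀ {t t′} → f t ≡ f t′ → t ≡ t′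
  f-injective {t} {t′} eq =
    row-injective (ℕP.suc-injective (trans (sym (f-height t)) (trans (cong (height G) eq) (f-height t′))))

  f≢last : ∀ t → f t ≢ last
  f≢last t eq = ℕP.<-irrefl (trans (sym (f-height t)) (trans (cong (height G) eq) last-height)) (row<r t)

  last<f : ∀ t → last F.< f t
  last<f t = ℕP.≤∧≢⇒< (proj₁ (proj₂ (proj₂ (fan t)))) (f≢last t ∘ sym ∘ FP.toℕ-injective)

  y-injective : Injective _≡_ _≡_ y
  y-injective {t} {t′} eq = f-injective (joins-unique (y-joins t) (subst (Joins G (f t′) u) (sym eq) (y-joins t′)))

  u≢y : ∀ t → u ≢ y t
  u≢y t = joins-distinct (y-joins t)

  v≢y : ∀ t → v ≢ y t
  v≢y t eq = f≢last t (joins-unique (subst (Joins G (f t) u) (sym eq) (y-joins t)) (joins-sym last-joins))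

  u≢v : u ≢ v
  u≢v = FP.fromℕ≢inject₁ ∘ MonotonePath.distinct path _ _

  -- u, v and the fan ends are k + 3 distinct vertices, while the path has
  -- k + 2; so some fan end lies off the path.
  fresh-fan-end : ∃ λ t → ∀ j → x j ≢ y t
  fresh-fan-end with fresh-among x (u Vector.∷ v Vector.∷ y)
                                  (cons-injective u-fresh (cons-injective v≢y y-injective))
    where
    u-fresh : ∀ i → u ≢ (v Vector.∷ y) i
    u-fresh zero    = u≢v
    u-fresh (suc t) = u≢y t
  ... | zero        , fresh = contradiction refl (fresh (fromℕ (suc k)))
  ... | suc zero    , fresh = contradiction refl (fresh (inject₁ (fromℕ k)))
  ... | suc (suc t) , fresh = t , fresh

  path-below-f : ∀ t i → e i F.< f t
  path-below-f t i = ℕP.≤-<-trans (edges-below-last path i) (last<f t)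

  f-high : ∀ t → suc (suc r) ∸ suc k ≤ height G (f t)
  f-high t = begin
    suc r ∸ k       ≡⟨ ℕP.+-∸-assoc 1 k≤r ⟩
    suc (r ∸ k)     ≤⟨ s≤s (ℕP.∸-monoʳ-≤ r (FP.toℕ≤pred[n] t)) ⟩
    suc (row t)     ≡⟨ sym (f-height t) ⟩
    height G (f t)  ∎
    where open ℕP.≤-Reasoning

lemma2p1 : (G : TOGraph) (k r : ℕ) → 1 ≤ k → k < r →
    (x : Fin (suc k) → Fin (TOGraph.n G)) (e : Fin k → Fin (TOGraph.m G)) →
    MonotonePath G k x e → PathHeight G k e r →
    Σ (Fin (TOGraph.n G)) λ y → Σ (Fin (TOGraph.m G)) λ f →
    MonotonePath G (suc k) (snoc x y) (snoc e f) × r ∸ k ≤ height G f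
lemma2p1 G (suc k) (suc (suc r)) (s≤s z≤n) (s≤s (s≤s k≤r)) x e path last-height =
  let (t , t-fresh) = fresh-fan-end
  in y t , f t , extend path t-fresh (y-joins t) (path-below-f t) , f-high t
  where
  open LastVertex G k≤r x e path last-height
  open Paths G
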